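{- Let $S=[s_{ij}]$ be a nonnegative integral $m\times n$ matrix, and set $s_{0j}=s_{i0}=0$ for all $i,j$. Then $S$ is the sum-matrix of a matrix in $\mathcal{S}^+_{m,n}$ if and only if $$s_{i,j-1}+s_{i-1,j}-s_{i-1,j-1}\le s_{ij}\quad(1\le i\le m,\ 1\le j\le n),\qquad s_{mj}\le s_{m,j-1}+1\quad(1\le j\le n).$$
   Context: $\mathcal{S}^+_{m,n}$ is the set of $m\times n$ $(0,1)$-matrices with at most one $1$ in each column (equivalently, $m\times n$ sign-restricted matrices with no entry $-1$). The sum-matrix of an $m\times n$ matrix $A=[a_{ij}]$ is $\Sigma(A)=[\sigma_{ij}]$ with $\sigma_{ij}=\sum_{p\le i,\,q\le j}a_{pq}$. -}

module Defs where

open import Data.Nat using (ℕ; zero; suc; _+_; _≤_; _≤?_)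
open import Relation.Nullary using (yes; no)
open import Data.Fin using (Fin; zero; suc; toℕ; inject₁)
open import Data.Product using (_×_; Σ)
open import Data.Sum using (_⊎_)
open import Relation.Binary.PropositionalEquality using (_≡_)

Matrix : Set → ℕ → ℕ → Set
Matrix A m n = Fin m → Fin n → A

∑ : (k : ℕ) → (Fin k → ℕ) → ℕ
∑ zero f = 0
∑ (suc k) f = f zero + ∑ k (λ i → f (suc i))

InSPlus : {m n : ℕ} → Matrix ℕ m n → Set
InSPlus {m} {n} A =
  ((i : Fin m) (j : Fin n) → (A i j ≡ 0) ⊎ (A i j ≡ 1))
  × ((j : Fin n) (i i' : Fin m) → A i j ≡ 1 → A i' j ≡ 1 → i ≡ i')

Σmat : {m n : ℕ} → Matrix ℕ m n → Matrix ℕ m n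
Σmat {m} {n} A i j =
  ∑ m (λ p → ∑ n (λ q → if≤ p i (if≤ q j (A p q))))
  where
    if≤ : {k : ℕ} → Fin k → Fin k → ℕ → ℕ
    if≤ a b x with toℕ a ≤? toℕ b
    ... | yes _ = x
    ... | no _ = 0

-- S extended by zero row 0 and zero column 0: ext S i j = s_{ij} for 0 ≤ i ≤ m, 0 ≤ j ≤ n
ext : {m n : ℕ} → Matrix ℕ m n → Fin (suc m) → Fin (suc n) → ℕ
ext S zero j = 0
ext S (suc i) zero = 0
ext S (suc i) (suc j) = S i j

-- Bordering the sum-matrix of A with a zero row and column gives a grid function Σext A, and it is
-- the unique grid function vanishing on the border whose mixed second differences
-- s_ij - s_(i-1)j - s_i(j-1) + s_(i-1)(j-1) are the entries of A. So S is the sum-matrix of a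
-- nonnegative matrix exactly when these differences of S are nonnegative (the first condition),
-- the matrix being the differences themselves. Moreover the increments of the last row of Σext A
-- are the column sums of A, and a nonnegative integer matrix lies in S⁺ exactly when all its
-- column sums are at most 1 (the second condition).
module Submission where

open import Defs

module SumMatrices where
  open import Data.Nat
  open import Data.Nat.Properties
  open import Data.Nat.Tactic.RingSolver using (solve-∀)
  open import Algebra.Properties.CommutativeSemigroup +-commutativeSemigroup using (interchange)
  open import Data.Fin using (Fin; zero; suc; toℕ; inject₁; fromℕ)
  import Data.Fin.Properties as Fin
  open import Data.Product using (Σ; _×_; _,_; proj₁; proj₂)
  open import Data.Sum using (_⊎_; inj₁; inj₂)
  open import Data.Empty using (⊥; ⊥-elim)
  open import Function using (_∘_; _⇔_; mk⇔; Equivalence)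
  open import Relation.Nullary using (¬_; yes; no)
  open import Relation.Binary.PropositionalEquality

  private variable
    k m n : ℕ

  ∑-cong : {f g : Fin k → ℕ} → (∀ p → f p ≡ g p) → ∑ k f ≡ ∑ k g
  ∑-cong {zero}  f≗g = refl
  ∑-cong {suc k} f≗g = cong₂ _+_ (f≗g zero) (∑-cong (f≗g ∘ suc))

  ∑-zeros : ∀ k → ∑ k (λ _ → 0) ≡ 0
  ∑-zeros zero    = refl
  ∑-zeros (suc k) = ∑-zeros k

  entry≤∑ : (f : Fin k → ℕ) (p : Fin k) → f p ≤ ∑ k f
  entry≤∑ f zero    = m≤m+n (f zero) _
  entry≤∑ f (suc p) = ≤-trans (entry≤∑ (f ∘ suc) p) (m≤n+m _ (f zero))

  AtMostOneOne : (Fin k → ℕ) → Set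
  AtMostOneOne f = (∀ p → f p ≡ 0 ⊎ f p ≡ 1) × (∀ p p′ → f p ≡ 1 → f p′ ≡ 1 → p ≡ p′)

  ∑≤1⇒¬ones-at-zero-and-suc : (f : Fin (suc k) → ℕ) → ∑ (suc k) f ≤ 1 →
                               ∀ p → f zero ≡ 1 → f (suc p) ≡ 1 → ⊥
  ∑≤1⇒¬ones-at-zero-and-suc f ∑≤1 p f0≡1 fp≡1 = <-irrefl refl (≤-trans two≤∑ ∑≤1)
    where
    two≤∑ : 2 ≤ ∑ (suc _) f
    two≤∑ = +-mono-≤ (≤-reflexive (sym f0≡1)) (subst (_≤ ∑ _ (f ∘ suc)) fp≡1 (entry≤∑ (f ∘ suc) p))

  ∑≤1⇒unique : (f : Fin k → ℕ) → ∑ k f ≤ 1 → ∀ p p′ → f p ≡ 1 → f p′ ≡ 1 → p ≡ p′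
  ∑≤1⇒unique f ∑≤1 zero    zero     _    _     = refl
  ∑≤1⇒unique f ∑≤1 zero    (suc p′) f0≡1 fp′≡1 = ⊥-elim (∑≤1⇒¬ones-at-zero-and-suc f ∑≤1 p′ f0≡1 fp′≡1)
  ∑≤1⇒unique f ∑≤1 (suc p) zero     fp≡1 f0≡1  = ⊥-elim (∑≤1⇒¬ones-at-zero-and-suc f ∑≤1 p f0≡1 fp≡1)
  ∑≤1⇒unique f ∑≤1 (suc p) (suc p′) fp≡1 fp′≡1 =
    cong suc (∑≤1⇒unique (f ∘ suc) (≤-trans (m≤n+m _ (f zero)) ∑≤1) p p′ fp≡1 fp′≡1)

  atMostOneOne⇒∑≤1 : (f : Fin k → ℕ) → AtMostOneOne f → ∑ k f ≤ 1
  atMostOneOne⇒∑≤1 {zero}  f _                  = z≤n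
  atMostOneOne⇒∑≤1 {suc k} f (zero-one , unique) with zero-one zero
  ... | inj₁ f0≡0 = ≤-trans (≤-reflexive (cong (_+ ∑ k (f ∘ suc)) f0≡0))
    (atMostOneOne⇒∑≤1 (f ∘ suc) (zero-one ∘ suc , λ p p′ fp≡1 fp′≡1 → Fin.suc-injective (unique _ _ fp≡1 fp′≡1)))
  ... | inj₂ f0≡1 = ≤-reflexive (cong₂ _+_ f0≡1 (trans (∑-cong rest≡0) (∑-zeros k)))
    where
    rest≡0 : ∀ p → f (suc p) ≡ 0
    rest≡0 p with zero-one (suc p)
    ... | inj₁ fp≡0 = fp≡0
    ... | inj₂ fp≡1 with unique zero (suc p) f0≡1 fp≡1
    ... | ()

  ∑≤1⇔atMostOneOne : (f : Fin k → ℕ) → ∑ k f ≤ 1 ⇔ AtMostOneOne f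
  ∑≤1⇔atMostOneOne f = mk⇔
    (λ ∑≤1 → (λ p → n≤1⇒n≡0∨n≡1 (≤-trans (entry≤∑ f p) ∑≤1)) , ∑≤1⇒unique f ∑≤1)
    (atMostOneOne⇒∑≤1 f)

  inSPlus⇔columnSums≤1 : (A : Matrix ℕ m n) → InSPlus A ⇔ (∀ j → ∑ m (λ i → A i j) ≤ 1)
  inSPlus⇔columnSums≤1 {m} A = mk⇔
    (λ (zero-one , unique) j → Equivalence.from (∑≤1⇔atMostOneOne _) ((λ i → zero-one i j) , unique j))
    (λ ∑≤1 → (λ i j → proj₁ (column ∑≤1 j) i) , λ j → proj₂ (column ∑≤1 j))
    where
    column : (∀ j → ∑ m (λ i → A i j) ≤ 1) → ∀ j → AtMostOneOne (λ i → A i j)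
    column ∑≤1 j = Equivalence.to (∑≤1⇔atMostOneOne _) (∑≤1 j)

  prefixSum : (Fin k → ℕ) → Fin (suc k) → ℕ
  prefixSum f zero            = 0
  prefixSum {suc k} f (suc i) = f zero + prefixSum (f ∘ suc) i

  prefixSum-suc : (f : Fin k → ℕ) (i : Fin k) → prefixSum f (suc i) ≡ prefixSum f (inject₁ i) + f i
  prefixSum-suc f zero    = +-comm (f zero) 0
  prefixSum-suc f (suc i) = trans (cong (f zero +_) (prefixSum-suc (f ∘ suc) i)) (sym (+-assoc (f zero) _ _))

  prefixSum-fromℕ : (f : Fin k → ℕ) → prefixSum f (fromℕ k) ≡ ∑ k f
  prefixSum-fromℕ {zero}  f = refl
  prefixSum-fromℕ {suc k} f = cong (f zero +_) (prefixSum-fromℕ (f ∘ suc))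

  prefixSum-cong : {f g : Fin k → ℕ} → (∀ p → f p ≡ g p) → ∀ x → prefixSum f x ≡ prefixSum g x
  prefixSum-cong f≗g zero            = refl
  prefixSum-cong {suc k} f≗g (suc x) = cong₂ _+_ (f≗g zero) (prefixSum-cong (f≗g ∘ suc) x)

  prefixSum-zeros : ∀ x → prefixSum {k} (λ _ → 0) x ≡ 0
  prefixSum-zeros zero            = refl
  prefixSum-zeros {suc k} (suc x) = prefixSum-zeros x

  prefixSum-+ : (f g : Fin k → ℕ) → ∀ x → prefixSum (λ p → f p + g p) x ≡ prefixSum f x + prefixSum g x
  prefixSum-+ f g zero            = refl
  prefixSum-+ {suc k} f g (suc x) =
    trans (cong (f zero + g zero +_) (prefixSum-+ (f ∘ suc) (g ∘ suc) x)) (interchange (f zero) (g zero) _ _)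

  -- A structurally recursive copy of the local if≤ in the definition of Σmat.
  when≤ : Fin k → Fin k → ℕ → ℕ
  when≤ zero    _       x = x
  when≤ (suc p) zero    x = 0
  when≤ (suc p) (suc i) x = when≤ p i x

  when≤-yes : {p i : Fin k} {x : ℕ} → toℕ p ≤ toℕ i → when≤ p i x ≡ x
  when≤-yes {p = zero}          _         = refl
  when≤-yes {p = suc p} {suc i} (s≤s p≤i) = when≤-yes p≤i

  when≤-no : {p i : Fin k} {x : ℕ} → ¬ toℕ p ≤ toℕ i → when≤ p i x ≡ 0
  when≤-no {p = zero}          p≰i = ⊥-elim (p≰i z≤n)
  when≤-no {p = suc p} {zero}  _   = refl
  when≤-no {p = suc p} {suc i} p≰i = when≤-no (p≰i ∘ s≤s)

  when≤-∑ : (p i : Fin k) (g : Fin n → ℕ) → when≤ p i (∑ n g) ≡ ∑ n (λ q → when≤ p i (g q))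
  when≤-∑         zero    i       g = refl
  when≤-∑ {n = n} (suc p) zero    g = sym (∑-zeros n)
  when≤-∑         (suc p) (suc i) g = when≤-∑ p i g

  ∑-when≤ : (f : Fin k → ℕ) (i : Fin k) → ∑ k (λ p → when≤ p i (f p)) ≡ prefixSum f (suc i)
  ∑-when≤ {suc k} f zero    = cong (f zero +_) (∑-zeros k)
  ∑-when≤ {suc k} f (suc i) = cong (f zero +_) (∑-when≤ (f ∘ suc) i)

  Σext : Matrix ℕ m n → Matrix ℕ (suc m) (suc n)
  Σext A x y = prefixSum (λ p → prefixSum (A p) y) x

  -- The hole in Σmat-summand is the summand of Σmat, which mentions the local if≤ of Defs and so
  -- cannot be written down; it is solved by unification while checking Σmat≡∑∑when≤.
  mutual
    Σmat≡∑∑when≤ : (A : Matrix ℕ m n) (i : Fin m) (j : Fin n) →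
                   Σmat A i j ≡ ∑ m (λ p → ∑ n (λ q → when≤ p i (when≤ q j (A p q))))
    Σmat≡∑∑when≤ A i j = ∑-cong λ p → ∑-cong λ q → Σmat-summand A i j p q

    Σmat-summand : (A : Matrix ℕ m n) (i : Fin m) (j : Fin n) (p : Fin m) (q : Fin n) →
                   _ ≡ when≤ p i (when≤ q j (A p q))
    Σmat-summand A i j p q with toℕ p ≤? toℕ i | toℕ q ≤? toℕ j
    ... | yes p≤i | yes q≤j = sym (trans (when≤-yes p≤i) (when≤-yes q≤j))
    ... | yes p≤i | no  q≰j = sym (trans (when≤-yes p≤i) (when≤-no q≰j))
    ... | no  p≰i | _       = sym (when≤-no p≰i)

  Σmat≡Σext : (A : Matrix ℕ m n) (i : Fin m) (j : Fin n) → Σmat A i j ≡ Σext A (suc i) (suc j)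
  Σmat≡Σext {m} {n} A i j = begin
    Σmat A i j
      ≡⟨ Σmat≡∑∑when≤ A i j ⟩
    ∑ m (λ p → ∑ n (λ q → when≤ p i (when≤ q j (A p q))))
      ≡⟨ ∑-cong (λ p → sym (when≤-∑ p i (λ q → when≤ q j (A p q)))) ⟩
    ∑ m (λ p → when≤ p i (∑ n (λ q → when≤ q j (A p q))))
      ≡⟨ ∑-cong (λ p → cong (when≤ p i) (∑-when≤ (A p) j)) ⟩
    ∑ m (λ p → when≤ p i (prefixSum (A p) (suc j)))
      ≡⟨ ∑-when≤ _ i ⟩
    Σext A (suc i) (suc j) ∎
    where open ≡-Reasoning

  -- For i : Fin m, the rows inject₁ i and suc i of a bordered grid are consecutive.
  HasMixedDifferences : Matrix ℕ (suc m) (suc n) → Matrix ℕ m n → Set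
  HasMixedDifferences T A = ∀ i j →
    T (suc i) (suc j) + T (inject₁ i) (inject₁ j) ≡ (T (inject₁ i) (suc j) + T (suc i) (inject₁ j)) + A i j

  Supermodular : Matrix ℕ (suc m) (suc n) → Set
  Supermodular T = ∀ i j →
    T (inject₁ i) (suc j) + T (suc i) (inject₁ j) ≤ T (suc i) (suc j) + T (inject₁ i) (inject₁ j)

  -- Truncated subtraction, exact when T is supermodular.
  mixedDifferences : Matrix ℕ (suc m) (suc n) → Matrix ℕ m n
  mixedDifferences T i j =
    (T (suc i) (suc j) + T (inject₁ i) (inject₁ j)) ∸ (T (inject₁ i) (suc j) + T (suc i) (inject₁ j))

  hasMixedDifferences⇒supermodular : {T : Matrix ℕ (suc m) (suc n)} {A : Matrix ℕ m n} →
                                     HasMixedDifferences T A → Supermodular T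
  hasMixedDifferences⇒supermodular T-A i j = ≤-trans (m≤m+n _ _) (≤-reflexive (sym (T-A i j)))

  supermodular⇒hasMixedDifferences : {T : Matrix ℕ (suc m) (suc n)} →
                                     Supermodular T → HasMixedDifferences T (mixedDifferences T)
  supermodular⇒hasMixedDifferences T-sm i j = sym (m+[n∸m]≡n (T-sm i j))

  Σext-sucˡ : (A : Matrix ℕ m n) (i : Fin m) (y : Fin (suc n)) →
              Σext A (suc i) y ≡ Σext A (inject₁ i) y + prefixSum (A i) y
  Σext-sucˡ A i y = prefixSum-suc (λ p → prefixSum (A p) y) i

  Σext-sucʳ : (A : Matrix ℕ m n) (x : Fin (suc m)) (j : Fin n) →
              Σext A x (suc j) ≡ Σext A x (inject₁ j) + prefixSum (λ p → A p j) x
  Σext-sucʳ A x j = trans (prefixSum-cong (λ p → prefixSum-suc (A p) j) x) (prefixSum-+ _ _ x)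

  Σext-lastRow-suc : (A : Matrix ℕ m n) (j : Fin n) →
                     Σext A (fromℕ m) (suc j) ≡ Σext A (fromℕ m) (inject₁ j) + ∑ m (λ p → A p j)
  Σext-lastRow-suc {m} A j =
    trans (Σext-sucʳ A (fromℕ m) j) (cong (Σext A (fromℕ m) (inject₁ j) +_) (prefixSum-fromℕ (λ p → A p j)))

  Σext-hasMixedDifferences : (A : Matrix ℕ m n) → HasMixedDifferences (Σext A) A
  Σext-hasMixedDifferences A i j = begin
    S (suc i) (suc j) + S (ι i) (ι j)
      ≡⟨ cong (_+ S (ι i) (ι j)) (trans (Σext-sucˡ A i (suc j))
                                        (cong₂ _+_ (Σext-sucʳ A (ι i) j) (prefixSum-suc (A i) j))) ⟩
    (S (ι i) (ι j) + column) + (row + A i j) + S (ι i) (ι j)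
      ≡⟨ regroup (S (ι i) (ι j)) column row (A i j) ⟩
    (S (ι i) (ι j) + column) + (S (ι i) (ι j) + row) + A i j
      ≡⟨ cong (λ t → t + A i j) (cong₂ _+_ (sym (Σext-sucʳ A (ι i) j)) (sym (Σext-sucˡ A i (ι j)))) ⟩
    S (ι i) (suc j) + S (suc i) (ι j) + A i j ∎
    where
    open ≡-Reasoning
    S = Σext A
    ι = inject₁
    column = prefixSum (λ p → A p j) (ι i)
    row = prefixSum (A i) (ι j)
    regroup : ∀ s c r a → (s + c) + (r + a) + s ≡ (s + c) + (s + r) + a
    regroup = solve-∀

  agree-by-steps : {f g : Fin (suc k) → ℕ} (c d : Fin k → ℕ) → f zero ≡ g zero →
                   (∀ j → f (suc j) + c j ≡ f (inject₁ j) + d j) →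
                   (∀ j → g (suc j) + c j ≡ g (inject₁ j) + d j) →
                   ∀ y → f y ≡ g y
  agree-by-steps c d f0≡g0 f-steps g-steps zero = f0≡g0
  agree-by-steps {suc k} {f} {g} c d f0≡g0 f-steps g-steps (suc y) =
    agree-by-steps {f = f ∘ suc} {g ∘ suc} (c ∘ suc) (d ∘ suc) f1≡g1 (f-steps ∘ suc) (g-steps ∘ suc) y
    where
    f1≡g1 : f (suc zero) ≡ g (suc zero)
    f1≡g1 = +-cancelʳ-≡ (c zero) _ _ (begin
      f (suc zero) + c zero ≡⟨ f-steps zero ⟩
      f zero + d zero       ≡⟨ cong (_+ d zero) f0≡g0 ⟩
      g zero + d zero       ≡⟨ sym (g-steps zero) ⟩
      g (suc zero) + c zero ∎)
      where open ≡-Reasoning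

  ≗Σext⇔hasMixedDifferences : {T : Matrix ℕ (suc m) (suc n)} (A : Matrix ℕ m n) →
                              (∀ y → T zero y ≡ 0) → (∀ x → T x zero ≡ 0) →
                              (∀ x y → T x y ≡ Σext A x y) ⇔ HasMixedDifferences T A
  ≗Σext⇔hasMixedDifferences {T = T} A T0y≡0 Tx0≡0 = mk⇔ to from
    where
    ι = inject₁

    to : (∀ x y → T x y ≡ Σext A x y) → HasMixedDifferences T A
    to T≗S i j = begin
      T (suc i) (suc j) + T (ι i) (ι j)
        ≡⟨ cong₂ _+_ (T≗S _ _) (T≗S _ _) ⟩
      Σext A (suc i) (suc j) + Σext A (ι i) (ι j)
        ≡⟨ Σext-hasMixedDifferences A i j ⟩
      Σext A (ι i) (suc j) + Σext A (suc i) (ι j) + A i j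
        ≡⟨ cong (_+ A i j) (cong₂ _+_ (T≗S _ _) (T≗S _ _)) ⟨
      T (ι i) (suc j) + T (suc i) (ι j) + A i j ∎
      where open ≡-Reasoning

    from : HasMixedDifferences T A → ∀ x y → T x y ≡ Σext A x y
    from T-A x y = agree-by-steps (λ _ → 0) (λ i → prefixSum (A i) y) (T0y≡0 y)
      (λ i → trans (+-identityʳ _) (row-steps i y)) (λ i → trans (+-identityʳ _) (Σext-sucˡ A i y)) x
      where
      row-steps : ∀ i y → T (suc i) y ≡ T (ι i) y + prefixSum (A i) y
      row-steps i = agree-by-steps (λ j → T (ι i) (ι j)) (λ j → T (ι i) (suc j) + A i j)
        (trans (Tx0≡0 (suc i)) (sym (trans (+-identityʳ _) (Tx0≡0 (ι i))))) T-steps P-steps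
        where
        T-steps : ∀ j → T (suc i) (suc j) + T (ι i) (ι j) ≡ T (suc i) (ι j) + (T (ι i) (suc j) + A i j)
        T-steps j = trans (T-A i j) (+-assoc-comm (T (ι i) (suc j)) _ (A i j))
          where
          +-assoc-comm : ∀ a b c → (a + b) + c ≡ b + (a + c)
          +-assoc-comm = solve-∀
        P-steps : ∀ j → T (ι i) (suc j) + prefixSum (A i) (suc j) + T (ι i) (ι j)
                        ≡ T (ι i) (ι j) + prefixSum (A i) (ι j) + (T (ι i) (suc j) + A i j)
        P-steps j = trans (cong (λ t → T (ι i) (suc j) + t + T (ι i) (ι j)) (prefixSum-suc (A i) j))
                          (regroup (T (ι i) (suc j)) (prefixSum (A i) (ι j)) (A i j) (T (ι i) (ι j)))
          where
          regroup : ∀ t p a s → t + (p + a) + s ≡ s + p + (t + a)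
          regroup = solve-∀

  ext-zeroʳ : (S : Matrix ℕ m n) (x : Fin (suc m)) → ext S x zero ≡ 0
  ext-zeroʳ S zero    = refl
  ext-zeroʳ S (suc i) = refl

  Σmat≗⇔ext≗Σext : (A S : Matrix ℕ m n) →
                   (∀ i j → Σmat A i j ≡ S i j) ⇔ (∀ x y → ext S x y ≡ Σext A x y)
  Σmat≗⇔ext≗Σext A S = mk⇔ to from
    where
    to : (∀ i j → Σmat A i j ≡ S i j) → ∀ x y → ext S x y ≡ Σext A x y
    to ΣA≗S zero    y       = refl
    to ΣA≗S (suc i) zero    = sym (prefixSum-zeros (suc i))
    to ΣA≗S (suc i) (suc j) = trans (sym (ΣA≗S i j)) (Σmat≡Σext A i j)

    from : (∀ x y → ext S x y ≡ Σext A x y) → ∀ i j → Σmat A i j ≡ S i j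
    from S≗Σ i j = trans (Σmat≡Σext A i j) (sym (S≗Σ (suc i) (suc j)))

  LastRowIncrements≤1 : Matrix ℕ (suc m) (suc n) → Set
  LastRowIncrements≤1 {m} T = ∀ j → T (fromℕ m) (suc j) ≤ T (fromℕ m) (inject₁ j) + 1

  lastRowIncrements≤1⇔columnSums≤1 : {T : Matrix ℕ (suc m) (suc n)} (A : Matrix ℕ m n) →
                                     (∀ x y → T x y ≡ Σext A x y) →
                                     LastRowIncrements≤1 T ⇔ (∀ j → ∑ m (λ i → A i j) ≤ 1)
  lastRowIncrements≤1⇔columnSums≤1 {m} {T = T} A T≗Σ = mk⇔
    (λ steps j → +-cancelˡ-≤ (Σext A (fromℕ m) (inject₁ j)) _ _
                   (subst₂ _≤_ (last-step j) (cong (_+ 1) (T≗Σ _ _)) (steps j)))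
    (λ ∑≤1 j → subst₂ _≤_ (sym (last-step j)) (cong (_+ 1) (sym (T≗Σ _ _))) (+-monoʳ-≤ _ (∑≤1 j)))
    where
    last-step : ∀ j → T (fromℕ m) (suc j) ≡ Σext A (fromℕ m) (inject₁ j) + ∑ m (λ i → A i j)
    last-step j = trans (T≗Σ _ _) (Σext-lastRow-suc A j)

  sumMatrix⇔supermodular×lastRowIncrements≤1 : (S : Matrix ℕ m n) →
    Σ (Matrix ℕ m n) (λ A → InSPlus A × (∀ i j → Σmat A i j ≡ S i j))
      ⇔ (Supermodular (ext S) × LastRowIncrements≤1 (ext S))
  sumMatrix⇔supermodular×lastRowIncrements≤1 S = mk⇔ necessary sufficient
    where
    open Equivalence

    extS≗Σext⇔ : (A : Matrix ℕ _ _) → (∀ x y → ext S x y ≡ Σext A x y) ⇔ HasMixedDifferences (ext S) A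
    extS≗Σext⇔ A = ≗Σext⇔hasMixedDifferences A (λ _ → refl) (ext-zeroʳ S)

    necessary : Σ (Matrix ℕ _ _) (λ A → InSPlus A × (∀ i j → Σmat A i j ≡ S i j)) →
                Supermodular (ext S) × LastRowIncrements≤1 (ext S)
    necessary (A , A∈S⁺ , ΣA≗S) =
      hasMixedDifferences⇒supermodular {T = ext S} (to (extS≗Σext⇔ A) S≗Σ) ,
      from (lastRowIncrements≤1⇔columnSums≤1 A S≗Σ) (to (inSPlus⇔columnSums≤1 A) A∈S⁺)
      where
      S≗Σ = to (Σmat≗⇔ext≗Σext A S) ΣA≗S

    sufficient : Supermodular (ext S) × LastRowIncrements≤1 (ext S) →
                 Σ (Matrix ℕ _ _) (λ A → InSPlus A × (∀ i j → Σmat A i j ≡ S i j))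
    sufficient (S-sm , S-steps) =
      A , from (inSPlus⇔columnSums≤1 A) (to (lastRowIncrements≤1⇔columnSums≤1 A S≗Σ) S-steps) ,
      from (Σmat≗⇔ext≗Σext A S) S≗Σ
      where
      A = mixedDifferences (ext S)
      S≗Σ = from (extS≗Σext⇔ A) (supermodular⇒hasMixedDifferences {T = ext S} S-sm)

open SumMatrices using (Supermodular; LastRowIncrements≤1; sumMatrix⇔supermodular×lastRowIncrements≤1)

open import Algebra.Bundles using (AbelianGroup)
open import Data.Nat using (ℕ; suc)
open import Data.Fin using (Fin; suc; inject₁; fromℕ)
open import Data.Product using (Σ; _×_)
open import Data.Product.Function.NonDependent.Propositional using (_×-⇔_)
open import Data.Integer using (ℤ; +_; _+_; _-_; -_; _≤_; +≤+)
open import Data.Integer.Properties using (≤-trans; ≤-reflexive; +-monoˡ-≤; drop‿+≤+; +-0-abelianGroup)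
open import Algebra.Properties.Group (AbelianGroup.group +-0-abelianGroup) using (//-rightDividesˡ; //-rightDividesʳ)
open import Function using (_⇔_; mk⇔; Equivalence)
open import Function.Properties.Equivalence using () renaming (trans to ⇔-trans)
open import Relation.Binary.PropositionalEquality using (_≡_; sym)

i-k≤j⇔i≤j+k : {i j k : ℤ} → i - k ≤ j ⇔ i ≤ j + k
i-k≤j⇔i≤j+k {i} {j} {k} = mk⇔
  (λ i-k≤j → ≤-trans (≤-reflexive (sym (//-rightDividesˡ k i))) (+-monoˡ-≤ k i-k≤j))
  (λ i≤j+k → ≤-trans (+-monoˡ-≤ (- k) i≤j+k) (≤-reflexive (//-rightDividesʳ k j)))

supermodular⇔ℤ : {m n : ℕ} (S : Matrix ℕ m n) →
  Supermodular (ext S)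
    ⇔ ((i : Fin m) (j : Fin n) →
         (+ ext S (inject₁ i) (suc j)) + (+ ext S (suc i) (inject₁ j)) - (+ ext S (inject₁ i) (inject₁ j))
           ≤ + ext S (suc i) (suc j))
supermodular⇔ℤ S = mk⇔
  (λ S-sm i j → Equivalence.from (i-k≤j⇔i≤j+k {k = + ext S (inject₁ i) (inject₁ j)}) (+≤+ (S-sm i j)))
  (λ S-sm i j → drop‿+≤+ (Equivalence.to (i-k≤j⇔i≤j+k {k = + ext S (inject₁ i) (inject₁ j)}) (S-sm i j)))

lastRowIncrements≤1⇔ℤ : {m n : ℕ} (S : Matrix ℕ m n) →
  LastRowIncrements≤1 (ext S)
    ⇔ ((j : Fin n) → + ext S (fromℕ m) (suc j) ≤ (+ ext S (fromℕ m) (inject₁ j)) + + 1)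
lastRowIncrements≤1⇔ℤ S = mk⇔ (λ steps j → +≤+ (steps j)) (λ steps j → drop‿+≤+ (steps j))

lemma4p5 : (m n : ℕ) (S : Matrix ℕ m n) →
    (Σ (Matrix ℕ m n) (λ A → InSPlus A × ((i : Fin m) (j : Fin n) → Σmat A i j ≡ S i j)))
    ⇔
    (((i : Fin m) (j : Fin n) →
        (+ ext S (inject₁ i) (suc j)) + (+ ext S (suc i) (inject₁ j)) - (+ ext S (inject₁ i) (inject₁ j))
          ≤ + ext S (suc i) (suc j))
     × ((j : Fin n) → + ext S (fromℕ m) (suc j) ≤ (+ ext S (fromℕ m) (inject₁ j)) + + 1))
lemma4p5 m n S =
  ⇔-trans (sumMatrix⇔supermodular×lastRowIncrements≤1 S) (supermodular⇔ℤ S ×-⇔ lastRowIncrements≤1⇔ℤ S)
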